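{- Let $G$ be an instance of the TC* problem with parameters $n,\Delta,p$. Let $0<\gamma\le1$ be such that $n^\gamma$ is an integer, and let $k\in[n^{1-\gamma}]$. Let $I_k=\{kn^\gamma,\dots,(k+1)n^\gamma-1\}$. Define the graph $H=H_{\gamma,k}(G)$. Its nodes are: - the nodes of the parts $B$ and $C$ of $G$; - for each $i\in I_k$, nodes $a^i_0,\dots,a^i_{n-1}$ (forming $A_i$) and $t^i_0,\dots,t^i_{n-1}$ (forming $T_i$); let $A'=\bigcup_i A_i$ and $T=\bigcup_i T_i$; - a node $u$, nodes $v_i$ for $i\in I_k$, and nodes $w_1,w_2,w_3$. Its (undirected) edges are: - all edges of $G$ between $B$ and $C$; - $w_1$ adjacent to every node of $A'$ and to $w_2$; - $w_2$ adjacent to every node of $B\cup C$, to $w_3$ and to $u$; - $w_3$ adjacent to every node of $T$; - $u$ adjacent to every $v_i$; - for each $i\in I_k$: $v_i$ adjacent to all nodes of $T\setminus T_i$ and all nodes of $A_i$; - for each $i\in I_k$, $i'\in[n]$, and each edge $(a^i_j,b^{i'}_{j,x})$ of $G$: the edge $(a^i_{i'},b^{i'}_{j,x})$ in $H$; - for each $i\in I_k$, $i'\in[n]$, and each edge $(a^i_j,c^{i'}_{j,x})$ of $G$: the edge $(c^{i'}_{j,x},t^i_{i'})$ in $H$. Then for every $i\in I_k$ and all $\alpha,\beta\in[n]$, the distance in $H$ from $a^i_\alpha$ to $t^i_\beta$ is exactly $3$ if $G$ contains a triangle whose nodes in $A$, $B$, $C$ have colors $i$, $\alpha$, $\beta$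 respectively, and exactly $4$ otherwise.
   Context: TC* instance with parameters $n,\Delta,p$: an undirected node-colored tripartite graph $G$ with parts $A,B,C$. Each part has its own $n$ colors, identified with $[n]=\{0,\dots,n-1\}$. - $A$ consists of nodes $a^i_j$ with color $i\in[n]$ and $j\in[\Delta]$. - $B$ and $C$ consist of nodes $b^i_{j,x}$ and $c^i_{j,x}$ with color $i\in[n]$, $j\in[\Delta]$, $x\in[p]$. Edges of $G$: - for each $i,i'\in[n]$ and $j\in[\Delta]$, $a^i_j$ is adjacent to $b^{i'}_{j,x}$ for exactly one $x$, and to $c^{i'}_{j,y}$ for exactly one $y$; - an edge between $b^i_{j,x}$ and $c^{i'}_{j',y}$ may exist only if $j=j'$; - there are no other edges. The TC* question asks whether some triple of colors (one per part) has no triangle in $G$ with those colors. -}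

module Defs where

open import Data.Nat using (ℕ; zero; suc; _+_; _*_; _≤_; _<_)
open import Data.Fin using (Fin; toℕ)
open import Data.Bool using (Bool; true)
open import Data.Product using (Σ; ∃; _×_; _,_; proj₁)
open import Data.Sum using (_⊎_)
open import Data.Unit using (⊤)
open import Data.Empty using (⊥)
open import Relation.Nullary using (¬_)
open import Relation.Binary.PropositionalEquality using (_≡_)

-- A TC* instance with parameters n, Δ, p.
--   A-nodes a^i_j   : i : Fin n, j : Fin Δ
--   B-nodes b^i_{j,x}, C-nodes c^i_{j,x} : i : Fin n, j : Fin Δ, x : Fin p
-- "a^i_j is adjacent to b^{i'}_{j,x} for exactly one x" is encoded by the
-- function fB : a^i_j ~ b^{i'}_{j,x}  iff  x ≡ fB i i' j  (same for fC).
-- B–C edges only between nodes with the same j: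
--   b^i_{j,x} ~ c^{i'}_{j,y}  iff  bc i j x i' y ≡ true.

record TCInstance (n Δ p : ℕ) : Set where
  field
    fB : Fin n → Fin n → Fin Δ → Fin p
    fC : Fin n → Fin n → Fin Δ → Fin p
    bc : Fin n → Fin Δ → Fin p → Fin n → Fin p → Bool

module TC {n Δ p : ℕ} (G : TCInstance n Δ p) where
  open TCInstance G

  data GNode : Set where
    a : Fin n → Fin Δ → GNode
    b : Fin n → Fin Δ → Fin p → GNode
    c : Fin n → Fin Δ → Fin p → GNode

  GE : GNode → GNode → Set
  GE (a i j) (b i' j' x) = j ≡ j' × x ≡ fB i i' j
  GE (a i j) (c i' j' y) = j ≡ j' × y ≡ fC i i' j
  GE (b i j x) (c i' j' y) = j ≡ j' × bc i j x i' y ≡ true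
  GE _ _ = ⊥

  GAdj : GNode → GNode → Set
  GAdj u v = GE u v ⊎ GE v u

  HasTriangle : Fin n → Fin n → Fin n → Set
  HasTriangle i α β =
    Σ (Fin Δ) λ j → Σ (Fin Δ) λ j' → Σ (Fin p) λ x → Σ (Fin Δ) λ j'' → Σ (Fin p) λ y →
      GAdj (a i j) (b α j' x) × GAdj (a i j) (c β j'' y) × GAdj (b α j' x) (c β j'' y)

  -- The graph H = H_{γ,k}(G), where m = n^γ.
  -- I_k = {k m, …, (k+1) m - 1}, as colors in [n].
  module H (m k : ℕ) where

    Ik : Set
    Ik = Σ (Fin n) λ i → (k * m ≤ toℕ i) × (toℕ i < suc k * m)

    data HNode : Set where
      bN : Fin n → Fin Δ → Fin p → HNode
      cN : Fin n → Fin Δ → Fin p → HNode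
      aN : Ik → Fin n → HNode
      tN : Ik → Fin n → HNode
      uN : HNode
      vN : Ik → HNode
      w₁ w₂ w₃ : HNode

    HE : HNode → HNode → Set
    HE (bN i j x) (cN i' j' y) = j ≡ j' × bc i j x i' y ≡ true
    HE w₁ (aN _ _) = ⊤
    HE w₁ w₂ = ⊤
    HE w₂ (bN _ _ _) = ⊤
    HE w₂ (cN _ _ _) = ⊤
    HE w₂ w₃ = ⊤
    HE w₂ uN = ⊤
    HE w₃ (tN _ _) = ⊤
    HE uN (vN _) = ⊤
    HE (vN i) (tN i' _) = ¬ (proj₁ i ≡ proj₁ i')
    HE (vN i) (aN i' _) = proj₁ i ≡ proj₁ i'
    HE (aN i i') (bN i'' j x) = i'' ≡ i' × x ≡ fB (proj₁ i) i' j
    HE (cN i' j x) (tN i i'') = i'' ≡ i' × x ≡ fC (proj₁ i) i' j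
    HE _ _ = ⊥

    HAdj : HNode → HNode → Set
    HAdj u v = HE u v ⊎ HE v u

    data Walk : HNode → HNode → ℕ → Set where
      nil  : ∀ {x} → Walk x x zero
      cons : ∀ {x y z l} → HAdj x y → Walk y z l → Walk x z (suc l)

    Dist : HNode → HNode → ℕ → Set
    Dist x y d = Walk x y d × (∀ l → l < d → ¬ Walk x y l)

module Submission where

open import Defs
open import Data.Nat using (ℕ; _*_; _≤_; _<_; suc; s≤s)
open import Data.Nat.Properties using (m<1+n⇒m<n∨m≡n)
open import Data.Fin using (Fin)
open import Data.Product using (_×_; proj₁; _,_)
open import Data.Sum using (_⊎_; inj₁; inj₂)
open import Data.Unit using (tt)
open import Relation.Nullary using (¬_)
open import Relation.Binary.PropositionalEquality using (_≡_; refl)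

-- The neighbours of a^i_α are the B-nodes of color α adjacent to some a^i_j in G, w₁, and v_i;
-- those of t^i_β are the C-nodes of color β adjacent to some a^i_j, w₃, and the v_{i'} with
-- i' ≠ i.  The two neighbourhoods are disjoint, so the distance is at least 3, and an edge
-- between them must be a B–C edge of G closing a triangle with a^i_j.  The path
-- a^i_α – w₁ – w₂ – w₃ – t^i_β always has length 4.

lower-bound-suc : ∀ {P : ℕ → Set} {d} → (∀ l → l < d → ¬ P l) → ¬ P d → ∀ l → l < suc d → ¬ P l
lower-bound-suc ¬P<d ¬Pd l l<1+d with m<1+n⇒m<n∨m≡n l<1+d
... | inj₁ l<d  = ¬P<d l l<d
... | inj₂ refl = ¬Pd

module ShortestWalks {n Δ p : ℕ} (G : TCInstance n Δ p) (m k : ℕ)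
                   (i : TC.H.Ik G m k) (α β : Fin n) where
  open TCInstance G
  open TC G
  open H m k

  data NeighbourOfA : HNode → Set where
    viaB  : ∀ j → NeighbourOfA (bN α j (fB (proj₁ i) α j))
    viaW₁ : NeighbourOfA w₁
    viaV  : ∀ {i'} → proj₁ i' ≡ proj₁ i → NeighbourOfA (vN i')

  data NeighbourOfT : HNode → Set where
    viaC  : ∀ j → NeighbourOfT (cN β j (fC (proj₁ i) β j))
    viaW₃ : NeighbourOfT w₃
    viaV  : ∀ {i'} → ¬ proj₁ i' ≡ proj₁ i → NeighbourOfT (vN i')

  adj-aN⇒NeighbourOfA : ∀ y → HAdj (aN i α) y → NeighbourOfA y
  adj-aN⇒NeighbourOfA (bN _ j _) (inj₁ (refl , refl)) = viaB j
  adj-aN⇒NeighbourOfA (vN _)     (inj₂ e)             = viaV e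
  adj-aN⇒NeighbourOfA w₁         (inj₂ _)             = viaW₁
  adj-aN⇒NeighbourOfA (bN _ _ _) (inj₂ ())
  adj-aN⇒NeighbourOfA (cN _ _ _) (inj₁ ())
  adj-aN⇒NeighbourOfA (cN _ _ _) (inj₂ ())
  adj-aN⇒NeighbourOfA (aN _ _)   (inj₁ ())
  adj-aN⇒NeighbourOfA (aN _ _)   (inj₂ ())
  adj-aN⇒NeighbourOfA (tN _ _)   (inj₁ ())
  adj-aN⇒NeighbourOfA (tN _ _)   (inj₂ ())
  adj-aN⇒NeighbourOfA uN         (inj₁ ())
  adj-aN⇒NeighbourOfA uN         (inj₂ ())
  adj-aN⇒NeighbourOfA (vN _)     (inj₁ ())
  adj-aN⇒NeighbourOfA w₁         (inj₁ ())
  adj-aN⇒NeighbourOfA w₂         (inj₁ ())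
  adj-aN⇒NeighbourOfA w₂         (inj₂ ())
  adj-aN⇒NeighbourOfA w₃         (inj₁ ())
  adj-aN⇒NeighbourOfA w₃         (inj₂ ())

  adj-tN⇒NeighbourOfT : ∀ z → HAdj z (tN i β) → NeighbourOfT z
  adj-tN⇒NeighbourOfT (cN _ j _) (inj₁ (refl , refl)) = viaC j
  adj-tN⇒NeighbourOfT (vN _)     (inj₁ e)             = viaV e
  adj-tN⇒NeighbourOfT w₃         (inj₁ _)             = viaW₃
  adj-tN⇒NeighbourOfT (cN _ _ _) (inj₂ ())
  adj-tN⇒NeighbourOfT (bN _ _ _) (inj₁ ())
  adj-tN⇒NeighbourOfT (bN _ _ _) (inj₂ ())
  adj-tN⇒NeighbourOfT (aN _ _)   (inj₁ ())
  adj-tN⇒NeighbourOfT (aN _ _)   (inj₂ ())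
  adj-tN⇒NeighbourOfT (tN _ _)   (inj₁ ())
  adj-tN⇒NeighbourOfT (tN _ _)   (inj₂ ())
  adj-tN⇒NeighbourOfT uN         (inj₁ ())
  adj-tN⇒NeighbourOfT uN         (inj₂ ())
  adj-tN⇒NeighbourOfT (vN _)     (inj₂ ())
  adj-tN⇒NeighbourOfT w₁         (inj₁ ())
  adj-tN⇒NeighbourOfT w₁         (inj₂ ())
  adj-tN⇒NeighbourOfT w₂         (inj₁ ())
  adj-tN⇒NeighbourOfT w₂         (inj₂ ())
  adj-tN⇒NeighbourOfT w₃         (inj₂ ())

  neighbourhoods-disjoint : ∀ {y} → NeighbourOfA y → ¬ NeighbourOfT y
  neighbourhoods-disjoint (viaV i'≡i) (viaV i'≢i) = i'≢i i'≡i

  adj-neighbourhoods⇒triangle : ∀ {y z} → NeighbourOfA y → NeighbourOfT z → HAdj y z →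
                                HasTriangle (proj₁ i) α β
  adj-neighbourhoods⇒triangle (viaB j) (viaC _) (inj₁ (refl , bc≡true)) =
    j , j , _ , j , _ , inj₁ (refl , refl) , inj₁ (refl , refl) , inj₁ (refl , bc≡true)
  adj-neighbourhoods⇒triangle (viaB _) (viaC _) (inj₂ ())
  adj-neighbourhoods⇒triangle (viaB _) viaW₃    (inj₁ ())
  adj-neighbourhoods⇒triangle (viaB _) viaW₃    (inj₂ ())
  adj-neighbourhoods⇒triangle (viaB _) (viaV _) (inj₁ ())
  adj-neighbourhoods⇒triangle (viaB _) (viaV _) (inj₂ ())
  adj-neighbourhoods⇒triangle viaW₁    (viaC _) (inj₁ ())
  adj-neighbourhoods⇒triangle viaW₁    (viaC _) (inj₂ ())
  adj-neighbourhoods⇒triangle viaW₁    viaW₃    (inj₁ ())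
  adj-neighbourhoods⇒triangle viaW₁    viaW₃    (inj₂ ())
  adj-neighbourhoods⇒triangle viaW₁    (viaV _) (inj₁ ())
  adj-neighbourhoods⇒triangle viaW₁    (viaV _) (inj₂ ())
  adj-neighbourhoods⇒triangle (viaV _) (viaC _) (inj₁ ())
  adj-neighbourhoods⇒triangle (viaV _) (viaC _) (inj₂ ())
  adj-neighbourhoods⇒triangle (viaV _) viaW₃    (inj₁ ())
  adj-neighbourhoods⇒triangle (viaV _) viaW₃    (inj₂ ())
  adj-neighbourhoods⇒triangle (viaV _) (viaV _) (inj₁ ())
  adj-neighbourhoods⇒triangle (viaV _) (viaV _) (inj₂ ())

  no-walk-shorter-than-3 : ∀ l → l < 3 → ¬ Walk (aN i α) (tN i β) l
  no-walk-shorter-than-3 0 _ ()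
  no-walk-shorter-than-3 1 _ (cons (inj₁ ()) nil)
  no-walk-shorter-than-3 1 _ (cons (inj₂ ()) nil)
  no-walk-shorter-than-3 2 _ (cons {y = y} a~y (cons y~t nil)) =
    neighbourhoods-disjoint (adj-aN⇒NeighbourOfA y a~y) (adj-tN⇒NeighbourOfT y y~t)
  no-walk-shorter-than-3 (suc (suc (suc _))) (s≤s (s≤s (s≤s ())))

  walk₃⇒triangle : Walk (aN i α) (tN i β) 3 → HasTriangle (proj₁ i) α β
  walk₃⇒triangle (cons {y = y} a~y (cons {y = z} y~z (cons z~t nil))) =
    adj-neighbourhoods⇒triangle (adj-aN⇒NeighbourOfA y a~y) (adj-tN⇒NeighbourOfT z z~t) y~z

  triangle⇒walk₃ : HasTriangle (proj₁ i) α β → Walk (aN i α) (tN i β) 3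
  triangle⇒walk₃ (j , _ , x , _ , y , inj₁ (refl , refl) , inj₁ (refl , refl) , inj₁ (refl , bc≡true)) =
    cons {y = bN α j x} (inj₁ (refl , refl))
      (cons {y = cN β j y} (inj₁ (refl , bc≡true)) (cons (inj₁ (refl , refl)) nil))
  triangle⇒walk₃ (_ , _ , _ , _ , _ , inj₂ () , _ , _)
  triangle⇒walk₃ (_ , _ , _ , _ , _ , inj₁ _ , inj₂ () , _)
  triangle⇒walk₃ (_ , _ , _ , _ , _ , inj₁ _ , inj₁ _ , inj₂ ())

  walk₄-via-w₁w₂w₃ : Walk (aN i α) (tN i β) 4
  walk₄-via-w₁w₂w₃ = cons {y = w₁} (inj₂ tt) (cons {y = w₂} (inj₁ tt) (cons {y = w₃} (inj₁ tt) (cons (inj₁ tt) nil)))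

lemma3 : ∀ {n Δ p : ℕ} (G : TCInstance n Δ p) (m k : ℕ) →
    (m ≡ n ⊎ (2 ≤ m × m ≤ n)) → k * m < n →
    let open TC G in let open H m k in
    (i : Ik) (α β : Fin n) →
    (HasTriangle (proj₁ i) α β → Dist (aN i α) (tN i β) 3)
    × (¬ HasTriangle (proj₁ i) α β → Dist (aN i α) (tN i β) 4)
lemma3 G m k _ _ i α β =
  (λ triangle → triangle⇒walk₃ triangle , no-walk-shorter-than-3) ,
  (λ ¬triangle → walk₄-via-w₁w₂w₃ ,
     lower-bound-suc no-walk-shorter-than-3 (λ walk → ¬triangle (walk₃⇒triangle walk)))
  where open ShortestWalks G m k i α β
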